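{- Let $p$ be a prime number and let $f,g\in\mathbb{Z}[u]$ be polynomials with integer coefficients. Then $$\left(f(\mathbf{F}_{\mathbf{x}})\right)^{p}g(\mathbf{F}_{\mathbf{x}})\equiv f(\mathbf{F}_{\mathbf{x}})\,g(\mathbf{F}_{\mathbf{x}}) \pmod{p\mathbb{Z}_p[x]}.$$ In particular, for all non-negative integers $m,q,r,s$, $$\mathcal{F}_{mp+q}(x;r,s)\equiv \mathcal{F}_{m+q}(x;r,s)\pmod{p\mathbb{Z}_p[x]}.$$
   Context: ${n\brace k}$ denotes the Stirling numbers of the second kind and $\mathcal{F}_n(x)=\sum_{k=0}^n {n\brace k}k!\,x^k$ the Fubini polynomials. For a non-negative integer $r$, the $r$-Stirling number ${n\brace k}_r$ is the number of partitions of $\{1,\dots,n\}$ into $k$ nonempty blocks such that $1,\dots,r$ lie in distinct blocks; equivalently $(u+r)^n=\sum_{k=0}^n {n+r\brace k+r}_r (u)_k$, where $(\alpha)_k=\alpha(\alpha-1)\cdots(\alpha-k+1)$, $(\alpha)_0=1$. The $(r,s)$-Fubini polynomials are $\mathcal{F}_n(x;r,s)=\sum_{k=0}^n {n+r\brace k+r}_r (k+s)!\,x^k$. Umbral notation: for a polynomial $h(u)=\sum_k c_k u^k$ in an indeterminate $u$ (coefficients may depend on $x$), $h(\mathbf{F}_{\mathbf{x}}):=\sum_k c_k\mathcal{F}_k(x)$, i.e. the image of $h$ under the linear map $u^k\mapsto\mathcal{F}_k(x)$. An expression such as $(f(\mathbf{F}_{\mathbf{x}}))^p g(\mathbf{F}_{\mathbf{x}})$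 means: first form the polynomial $f(u)^p g(u)$ in $u$, then apply this linear map. For polynomials in $\mathbb{Z}_p[x]$ ($\mathbb{Z}_p$ the $p$-adic integers), $A\equiv B\pmod{p\mathbb{Z}_p[x]}$ means corresponding coefficients of $A$ and $B$ are congruent modulo $p$. -}

module Defs where

open import Data.Nat as ℕ using (ℕ; zero; suc)
open import Data.Nat using (_!)
open import Data.Integer as ℤ using (ℤ; +_)
open import Data.Integer.Divisibility using (_∣_)
open import Data.List using (List; []; _∷_; map; upTo; lookup)

-- Polynomials with integer coefficients, as coefficient lists
-- (constant term first).  Used both for ℤ[u] and ℤ[x].
Poly : Set
Poly = List ℤ

coeff : Poly → ℕ → ℤ
coeff []       _       = + 0
coeff (a ∷ _)  zero    = a
coeff (_ ∷ as) (suc i) = coeff as i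

infixl 6 _+ₚ_
infixl 7 _*ₚ_ _·ₚ_
infixr 8 _^ₚ_

_+ₚ_ : Poly → Poly → Poly
[]       +ₚ q        = q
(a ∷ as) +ₚ []       = a ∷ as
(a ∷ as) +ₚ (b ∷ bs) = (a ℤ.+ b) ∷ (as +ₚ bs)

_·ₚ_ : ℤ → Poly → Poly
c ·ₚ q = map (c ℤ.*_) q

_*ₚ_ : Poly → Poly → Poly
[]       *ₚ q = []
(a ∷ as) *ₚ q = (a ·ₚ q) +ₚ (+ 0 ∷ (as *ₚ q))

oneₚ : Poly
oneₚ = + 1 ∷ []

_^ₚ_ : Poly → ℕ → Poly
q ^ₚ zero  = oneₚ
q ^ₚ suc n = q *ₚ (q ^ₚ n)

_≡ₚ_[mod_] : Poly → Poly → ℕ → Set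
A ≡ₚ B [mod p ] = ∀ (i : ℕ) → (+ p) ∣ (coeff A i ℤ.- coeff B i)

-- rStir r n k = {n+r brace k+r}_r  (r-Stirling numbers of the second kind),
-- by the standard recurrence: the element n+r+1 either forms a new
-- singleton block or joins one of the k+r existing blocks.
rStir : ℕ → ℕ → ℕ → ℕ
rStir r zero    zero    = 1
rStir r zero    (suc k) = 0
rStir r (suc n) zero    = r ℕ.* rStir r n zero
rStir r (suc n) (suc k) = rStir r n k ℕ.+ (suc k ℕ.+ r) ℕ.* rStir r n (suc k)

Stir : ℕ → ℕ → ℕ
Stir n k = rStir 0 n k

Fubini : ℕ → Poly
Fubini n = map (λ k → + (Stir n k ℕ.* (k !))) (upTo (suc n))

FubiniRS : ℕ → ℕ → ℕ → Poly
FubiniRS n r s = map (λ k → + (rStir r n k ℕ.* ((k ℕ.+ s) !))) (upTo (suc n))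

-- umbral evaluation h(F_x) = Σ_k c_k F_k(x) for h(u) = Σ_k c_k u^k
umbralAux : ℕ → Poly → Poly
umbralAux k []       = []
umbralAux k (c ∷ cs) = (c ·ₚ Fubini k) +ₚ umbralAux (suc k) cs

umbral : Poly → Poly
umbral h = umbralAux 0 h

-- Write Δ for the forward difference operator on integer sequences.
-- Since (j + r)ⁿ = Σₖ {n+r brace k+r}_r (j)ₖ, the k-th difference of
-- j ↦ (j + r)ⁿ at 0 is k!·{n+r brace k+r}_r; this is proved directly from
-- the r-Stirling recurrence and a Leibniz rule for Δ.  Consequently the
-- i-th coefficient of the umbral evaluation h(F_x) is Δⁱ(j ↦ h(j)) at 0,
-- and the k-th coefficient of F_N(x;r,s) is Δᵏ((j + r)ᴺ) at 0 times the
-- integer (k+s)!/k!.  Differences of pointwise congruent sequences are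
-- congruent, so both congruences of the theorem reduce to congruences of
-- integer values, which are Fermat's little theorem.
module Submission where

open import Defs
open import Data.Nat as ℕ using (ℕ; zero; suc; _!; _<_; _≤_; s≤s; z≤n)
import Data.Nat.Properties as ℕP
open import Data.Nat.Combinatorics using (_C_; nCn≡1; nC1≡n; nCk+nC[k+1]≡[n+1]C[k+1])
open import Data.Nat.Combinatorics.Specification using (k>n⇒nCk≡0)
import Data.Nat.Divisibility as ℕᵈ
open import Data.Nat.Primality using (Prime; euclidsLemma; prime⇒nonTrivial)
open import Data.Integer using (ℤ; +_; -[1+_]; 0ℤ; 1ℤ; -1ℤ; _+_; _-_; _*_; -_; _^_)
import Data.Integer.Properties as ℤP
open import Data.Integer.Divisibility.Signed
  using (_∣_; divides; ∣m∣n⇒∣m+n; ∣m⇒∣-m; ∣n⇒∣m*n; ∣m⇒∣m*n; ∣ᵤ⇒∣; ∣⇒∣ᵤ)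
open import Data.Integer.Tactic.RingSolver using (solve-∀)
import Data.Nat.Tactic.RingSolver as ℕ-Solver
open import Data.List using ([]; _∷_; map; applyUpTo)
open import Data.Sum using (inj₁; inj₂)
open import Data.Product using (_×_; _,_)
open import Data.Empty using (⊥-elim)
open import Relation.Binary.Definitions using (Tri; tri<; tri≈; tri>)
open import Relation.Binary.PropositionalEquality
open ≡-Reasoning

-- Congruence of integers modulo a natural number n, phrased through
-- signed divisibility so that the library's divisibility lemmas apply.
-- (A record rather than a plain abbreviation, so that a and b can be
-- inferred from the type.)
infix 4 _≡ᶻ_[mod_]
record _≡ᶻ_[mod_] (a b : ℤ) (n : ℕ) : Set where
  constructor mod-by
  field divides-difference : + n ∣ a - b
open _≡ᶻ_[mod_] public

module _ {n : ℕ} where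

  ∣-resp : ∀ {x y} → x ≡ y → + n ∣ x → + n ∣ y
  ∣-resp refl d = d

  ≡ᶻ-reflexive : ∀ {a b} → a ≡ b → a ≡ᶻ b [mod n ]
  ≡ᶻ-reflexive {a} refl = mod-by (divides 0ℤ (trans (ℤP.+-inverseʳ a) (sym (ℤP.*-zeroˡ (+ n)))))

  ≡ᶻ-refl : ∀ {a} → a ≡ᶻ a [mod n ]
  ≡ᶻ-refl = ≡ᶻ-reflexive refl

  ≡ᶻ-sym : ∀ {a b} → a ≡ᶻ b [mod n ] → b ≡ᶻ a [mod n ]
  ≡ᶻ-sym {a} {b} (mod-by d) = mod-by (∣-resp (negate a b) (∣m⇒∣-m d))
    where negate : ∀ a b → - (a - b) ≡ b - a
          negate = solve-∀

  ≡ᶻ-trans : ∀ {a b c} → a ≡ᶻ b [mod n ] → b ≡ᶻ c [mod n ] → a ≡ᶻ c [mod n ]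
  ≡ᶻ-trans {a} {b} {c} (mod-by d) (mod-by e) = mod-by (∣-resp (telescope a b c) (∣m∣n⇒∣m+n d e))
    where telescope : ∀ a b c → (a - b) + (b - c) ≡ a - c
          telescope = solve-∀

  +-cong : ∀ {a b c d} → a ≡ᶻ b [mod n ] → c ≡ᶻ d [mod n ] → a + c ≡ᶻ b + d [mod n ]
  +-cong {a} {b} {c} {d} (mod-by e) (mod-by f) = mod-by (∣-resp (regroup a b c d) (∣m∣n⇒∣m+n e f))
    where regroup : ∀ a b c d → (a - b) + (c - d) ≡ (a + c) - (b + d)
          regroup = solve-∀

  -‿cong : ∀ {a b c d} → a ≡ᶻ b [mod n ] → c ≡ᶻ d [mod n ] → a - c ≡ᶻ b - d [mod n ]
  -‿cong {a} {b} {c} {d} (mod-by e) (mod-by f) = mod-by (∣-resp (regroup a b c d) (∣m∣n⇒∣m+n e (∣m⇒∣-m f)))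
    where regroup : ∀ a b c d → (a - b) + - (c - d) ≡ (a - c) - (b - d)
          regroup = solve-∀

  *-cong : ∀ {a b c d} → a ≡ᶻ b [mod n ] → c ≡ᶻ d [mod n ] → a * c ≡ᶻ b * d [mod n ]
  *-cong {a} {b} {c} {d} (mod-by e) (mod-by f) = mod-by (∣-resp (regroup a b c d) (∣m∣n⇒∣m+n (∣m⇒∣m*n c e) (∣n⇒∣m*n b f)))
    where regroup : ∀ a b c d → (a - b) * c + b * (c - d) ≡ a * c - b * d
          regroup = solve-∀

  ∣⇒≡ᶻ0 : ∀ {a} → + n ∣ a → a ≡ᶻ 0ℤ [mod n ]
  ∣⇒≡ᶻ0 {a} d = mod-by (∣-resp (sym (ℤP.+-identityʳ a)) d)

  ^-cong : ∀ {a b} k → a ≡ᶻ b [mod n ] → a ^ k ≡ᶻ b ^ k [mod n ]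
  ^-cong zero    e = ≡ᶻ-refl
  ^-cong (suc k) e = *-cong e (^-cong k e)

eval : Poly → ℤ → ℤ
eval []       x = 0ℤ
eval (a ∷ as) x = a + x * eval as x

coeff-+ : ∀ A B i → coeff (A +ₚ B) i ≡ coeff A i + coeff B i
coeff-+ []       B        i       = sym (ℤP.+-identityˡ _)
coeff-+ (a ∷ as) []       i       = sym (ℤP.+-identityʳ _)
coeff-+ (a ∷ as) (b ∷ bs) zero    = refl
coeff-+ (a ∷ as) (b ∷ bs) (suc i) = coeff-+ as bs i

coeff-· : ∀ c A i → coeff (c ·ₚ A) i ≡ c * coeff A i
coeff-· c []       i       = sym (ℤP.*-zeroʳ c)
coeff-· c (a ∷ as) zero    = refl
coeff-· c (a ∷ as) (suc i) = coeff-· c as i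

eval-+ : ∀ A B x → eval (A +ₚ B) x ≡ eval A x + eval B x
eval-+ []       B        x = sym (ℤP.+-identityˡ _)
eval-+ (a ∷ as) []       x = sym (ℤP.+-identityʳ _)
eval-+ (a ∷ as) (b ∷ bs) x = begin
  a + b + x * eval (as +ₚ bs) x          ≡⟨ cong (λ v → a + b + x * v) (eval-+ as bs x) ⟩
  a + b + x * (eval as x + eval bs x)    ≡⟨ regroup a b x (eval as x) (eval bs x) ⟩
  a + x * eval as x + (b + x * eval bs x) ∎
  where regroup : ∀ a b x u v → a + b + x * (u + v) ≡ a + x * u + (b + x * v)
        regroup = solve-∀

eval-· : ∀ c A x → eval (c ·ₚ A) x ≡ c * eval A x
eval-· c []       x = sym (ℤP.*-zeroʳ c)
eval-· c (a ∷ as) x = begin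
  c * a + x * eval (c ·ₚ as) x ≡⟨ cong (λ v → c * a + x * v) (eval-· c as x) ⟩
  c * a + x * (c * eval as x)  ≡⟨ regroup c a x (eval as x) ⟩
  c * (a + x * eval as x)      ∎
  where regroup : ∀ c a x u → c * a + x * (c * u) ≡ c * (a + x * u)
        regroup = solve-∀

eval-* : ∀ A B x → eval (A *ₚ B) x ≡ eval A x * eval B x
eval-* []       B x = refl
eval-* (a ∷ as) B x = begin
  eval ((a ·ₚ B) +ₚ (+ 0 ∷ (as *ₚ B))) x       ≡⟨ eval-+ (a ·ₚ B) _ x ⟩
  eval (a ·ₚ B) x + (+ 0 + x * eval (as *ₚ B) x) ≡⟨ cong₂ (λ u v → u + (+ 0 + x * v)) (eval-· a B x) (eval-* as B x) ⟩
  a * eval B x + (+ 0 + x * (eval as x * eval B x)) ≡⟨ regroup a x (eval as x) (eval B x) ⟩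
  (a + x * eval as x) * eval B x                 ∎
  where regroup : ∀ a x u v → a * v + (0ℤ + x * (u * v)) ≡ (a + x * u) * v
        regroup = solve-∀

eval-one : ∀ x → eval oneₚ x ≡ 1ℤ
eval-one x = trans (cong (λ v → 1ℤ + v) (ℤP.*-zeroʳ x)) (ℤP.+-identityʳ 1ℤ)

eval-^ : ∀ A k x → eval (A ^ₚ k) x ≡ eval A x ^ k
eval-^ A zero    x = eval-one x
eval-^ A (suc k) x = trans (eval-* A (A ^ₚ k) x) (cong (eval A x *_) (eval-^ A k x))

eval-divisible : ∀ {n} A x → (∀ i → + n ∣ coeff A i) → + n ∣ eval A x
eval-divisible {n} []       x d = divides 0ℤ (sym (ℤP.*-zeroˡ (+ n)))
eval-divisible (a ∷ as) x d =
  ∣m∣n⇒∣m+n (d zero) (∣n⇒∣m*n x (eval-divisible as x (λ i → d (suc i))))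

eval-cong : ∀ {n} A B x → (∀ i → coeff A i ≡ᶻ coeff B i [mod n ]) →
            eval A x ≡ᶻ eval B x [mod n ]
eval-cong {n} A B x h = mod-by (∣-resp value (eval-divisible (A +ₚ (-1ℤ ·ₚ B)) x coefficient))
  where
  asDifference : ∀ a b → a + -1ℤ * b ≡ a - b
  asDifference = solve-∀
  coefficient : ∀ i → + n ∣ coeff (A +ₚ (-1ℤ ·ₚ B)) i
  coefficient i = ∣-resp (sym (trans (coeff-+ A _ i)
                     (trans (cong (λ v → coeff A i + v) (coeff-· -1ℤ B i)) (asDifference (coeff A i) (coeff B i)))))
                    (divides-difference (h i))
  value : eval (A +ₚ (-1ℤ ·ₚ B)) x ≡ eval A x - eval B x
  value = trans (eval-+ A _ x) (trans (cong (λ v → eval A x + v) (eval-· -1ℤ B x)) (asDifference (eval A x) (eval B x)))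

coeff-cons-* : ∀ a as B i → coeff ((a ∷ as) *ₚ B) i ≡ a * coeff B i + coeff (+ 0 ∷ (as *ₚ B)) i
coeff-cons-* a as B i = trans (coeff-+ (a ·ₚ B) _ i) (cong (_+ coeff (+ 0 ∷ (as *ₚ B)) i) (coeff-· a B i))

1+u : Poly
1+u = + 1 ∷ + 1 ∷ []

monomial : ℕ → Poly
monomial zero    = oneₚ
monomial (suc k) = + 0 ∷ monomial k

coeff-monomial-diag : ∀ k → coeff (monomial k) k ≡ 1ℤ
coeff-monomial-diag zero    = refl
coeff-monomial-diag (suc k) = coeff-monomial-diag k

coeff-monomial-off : ∀ k i → i ≢ k → coeff (monomial k) i ≡ 0ℤ
coeff-monomial-off zero    zero    i≢k = ⊥-elim (i≢k refl)
coeff-monomial-off zero    (suc i) i≢k = refl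
coeff-monomial-off (suc k) zero    i≢k = refl
coeff-monomial-off (suc k) (suc i) i≢k = coeff-monomial-off k i (λ i≡k → i≢k (cong suc i≡k))

eval-monomial : ∀ k x → eval (monomial k) x ≡ x ^ k
eval-monomial zero    x = eval-one x
eval-monomial (suc k) x = trans (ℤP.+-identityˡ _) (cong (x *_) (eval-monomial k x))

coeff-1+u-*-zero : ∀ P → coeff (1+u *ₚ P) 0 ≡ coeff P 0
coeff-1+u-*-zero P = trans (coeff-cons-* (+ 1) (+ 1 ∷ []) P 0) (trans (ℤP.+-identityʳ _) (ℤP.*-identityˡ _))

coeff-1+u-*-suc : ∀ P i → coeff (1+u *ₚ P) (suc i) ≡ coeff P i + coeff P (suc i)
coeff-1+u-*-suc P i = begin
  coeff (1+u *ₚ P) (suc i)                       ≡⟨ coeff-cons-* (+ 1) (+ 1 ∷ []) P (suc i) ⟩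
  + 1 * coeff P (suc i) + coeff ((+ 1 ∷ []) *ₚ P) i ≡⟨ cong (λ v → + 1 * coeff P (suc i) + v) (coeff-cons-* (+ 1) [] P i) ⟩
  + 1 * coeff P (suc i) + (+ 1 * coeff P i + coeff (+ 0 ∷ []) i)
    ≡⟨ cong (λ v → + 1 * coeff P (suc i) + (+ 1 * coeff P i + v)) (coeff-zero i) ⟩
  + 1 * coeff P (suc i) + (+ 1 * coeff P i + 0ℤ) ≡⟨ simplify (coeff P (suc i)) (coeff P i) ⟩
  coeff P i + coeff P (suc i)                    ∎
  where
  coeff-zero : ∀ i → coeff (+ 0 ∷ []) i ≡ 0ℤ
  coeff-zero zero    = refl
  coeff-zero (suc i) = refl
  simplify : ∀ a b → 1ℤ * a + (1ℤ * b + 0ℤ) ≡ b + a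
  simplify = solve-∀

coeff-binomial : ∀ n i → coeff (1+u ^ₚ n) i ≡ + (n C i)
coeff-binomial zero    zero    = refl
coeff-binomial zero    (suc i) = refl
coeff-binomial (suc n) zero    = trans (coeff-1+u-*-zero (1+u ^ₚ n)) (coeff-binomial n zero)
coeff-binomial (suc n) (suc i) = begin
  coeff (1+u *ₚ (1+u ^ₚ n)) (suc i)                 ≡⟨ coeff-1+u-*-suc (1+u ^ₚ n) i ⟩
  coeff (1+u ^ₚ n) i + coeff (1+u ^ₚ n) (suc i)     ≡⟨ cong₂ _+_ (coeff-binomial n i) (coeff-binomial n (suc i)) ⟩
  + (n C i) + + (n C suc i)                          ≡⟨ ℤP.pos-+ (n C i) (n C suc i) ⟨
  + (n C i ℕ.+ n C suc i)                            ≡⟨ cong +_ (nCk+nC[k+1]≡[n+1]C[k+1] n i) ⟩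
  + (suc n C suc i)                                  ∎

absorption : ∀ n k → suc k ℕ.* (suc n C suc k) ≡ suc n ℕ.* (n C k)
absorption zero    zero    = refl
absorption zero    (suc k) = trans (cong (suc (suc k) ℕ.*_) (k>n⇒nCk≡0 {1} {suc (suc k)} (s≤s (s≤s z≤n)))) (ℕP.*-zeroʳ (suc (suc k)))
absorption (suc n) zero    = trans (ℕP.*-identityˡ _) (trans (nC1≡n (suc (suc n))) (sym (ℕP.*-identityʳ _)))
absorption (suc n) (suc k) = begin
  suc (suc k) ℕ.* (suc (suc n) C suc (suc k))
    ≡⟨ cong (suc (suc k) ℕ.*_) (sym (nCk+nC[k+1]≡[n+1]C[k+1] (suc n) (suc k))) ⟩
  suc (suc k) ℕ.* (x ℕ.+ y)
    ≡⟨ expand k x y ⟩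
  x ℕ.+ suc k ℕ.* x ℕ.+ suc (suc k) ℕ.* y
    ≡⟨ cong₂ (λ u v → x ℕ.+ u ℕ.+ v) (absorption n k) (absorption n (suc k)) ⟩
  x ℕ.+ suc n ℕ.* (n C k) ℕ.+ suc n ℕ.* (n C suc k)
    ≡⟨ collect n x (n C k) (n C suc k) ⟩
  x ℕ.+ suc n ℕ.* (n C k ℕ.+ n C suc k)
    ≡⟨ cong (λ v → x ℕ.+ suc n ℕ.* v) (nCk+nC[k+1]≡[n+1]C[k+1] n k) ⟩
  x ℕ.+ suc n ℕ.* x
    ∎
  where
  x = suc n C suc k
  y = suc n C suc (suc k)
  expand : ∀ k x y → suc (suc k) ℕ.* (x ℕ.+ y) ≡ x ℕ.+ suc k ℕ.* x ℕ.+ suc (suc k) ℕ.* y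
  expand = ℕ-Solver.solve-∀
  collect : ∀ n x a b → x ℕ.+ suc n ℕ.* a ℕ.+ suc n ℕ.* b ≡ x ℕ.+ suc n ℕ.* (a ℕ.+ b)
  collect = ℕ-Solver.solve-∀

prime-∣-binomial : ∀ {p i} → Prime p → 0 < i → i < p → p ℕᵈ.∣ p C i
prime-∣-binomial {suc m} {suc k} pp _ i<p
  with euclidsLemma (suc k) (suc m C suc k) pp
         (ℕᵈ.divides (m C k) (trans (absorption m k) (ℕP.*-comm (suc m) (m C k))))
... | inj₁ p∣i = ⊥-elim (ℕP.<⇒≱ i<p (ℕᵈ.∣⇒≤ p∣i))
... | inj₂ p∣C = p∣C

-- For a prime p the middle binomial coefficients vanish mod p, so
-- (1 + u)^p and 1 + u^p agree coefficientwise mod p.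
binomial-mod-prime : ∀ {p} → Prime p → ∀ i →
                     coeff (1+u ^ₚ p) i ≡ᶻ coeff (oneₚ +ₚ monomial p) i [mod p ]
binomial-mod-prime {zero} pp i with ℕ.nonTrivial⇒n>1 0 {{prime⇒nonTrivial pp}}
... | ()
binomial-mod-prime {suc m} pp zero = ≡ᶻ-reflexive (coeff-binomial (suc m) zero)
binomial-mod-prime {suc m} pp (suc k) =
  ≡ᶻ-trans (≡ᶻ-reflexive (coeff-binomial (suc m) (suc k)))
           (middle (ℕP.<-cmp k m))
  where
  middle : Tri (k < m) (k ≡ m) (m < k) → + (suc m C suc k) ≡ᶻ coeff (monomial m) k [mod suc m ]
  middle (tri< k<m _ _) = ≡ᶻ-trans (∣⇒≡ᶻ0 (∣ᵤ⇒∣ (prime-∣-binomial pp (s≤s z≤n) (s≤s k<m))))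
                                   (≡ᶻ-reflexive (sym (coeff-monomial-off m k (ℕP.<⇒≢ k<m))))
  middle (tri≈ _ refl _) = ≡ᶻ-reflexive (trans (cong +_ (nCn≡1 (suc k))) (sym (coeff-monomial-diag k)))
  middle (tri> _ _ k>m) = ≡ᶻ-reflexive (trans (cong +_ (k>n⇒nCk≡0 (s≤s k>m)))
                                             (sym (coeff-monomial-off m k (ℕP.>⇒≢ k>m))))

freshman : ∀ {p} → Prime p → ∀ x → (1ℤ + x) ^ p ≡ᶻ 1ℤ + x ^ p [mod p ]
freshman {p} pp x =
  ≡ᶻ-trans (≡ᶻ-reflexive (sym lhs))
           (≡ᶻ-trans (eval-cong (1+u ^ₚ p) (oneₚ +ₚ monomial p) x (binomial-mod-prime pp))
                     (≡ᶻ-reflexive rhs))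
  where
  eval-1+u : ∀ x → 1ℤ + x * (1ℤ + x * 0ℤ) ≡ 1ℤ + x
  eval-1+u = solve-∀
  lhs : eval (1+u ^ₚ p) x ≡ (1ℤ + x) ^ p
  lhs = trans (eval-^ 1+u p x) (cong (_^ p) (eval-1+u x))
  rhs : eval (oneₚ +ₚ monomial p) x ≡ 1ℤ + x ^ p
  rhs = trans (eval-+ oneₚ (monomial p) x) (cong₂ _+_ (eval-one x) (eval-monomial p x))

-- Fermat's little theorem: a^p ≡ a (mod p) for every integer a.  By the
-- freshman's dream the property passes from x to 1 + x and back, so it
-- spreads from 1 (where it is trivial) to all of ℤ.
module _ {p : ℕ} (pp : Prime p) where

  private
    step-up : ∀ {x} → x ^ p ≡ᶻ x [mod p ] → (1ℤ + x) ^ p ≡ᶻ 1ℤ + x [mod p ]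
    step-up {x} h = ≡ᶻ-trans (freshman pp x) (+-cong (≡ᶻ-refl {a = 1ℤ}) h)

    step-down : ∀ {x} → (1ℤ + x) ^ p ≡ᶻ 1ℤ + x [mod p ] → x ^ p ≡ᶻ x [mod p ]
    step-down {x} h =
      ≡ᶻ-trans (≡ᶻ-reflexive (cancel (x ^ p)))
       (≡ᶻ-trans (-‿cong (≡ᶻ-sym (freshman pp x)) ≡ᶻ-refl)
        (≡ᶻ-trans (-‿cong h ≡ᶻ-refl) (≡ᶻ-reflexive (sym (cancel x)))))
      where cancel : ∀ y → y ≡ (1ℤ + y) - 1ℤ
            cancel = solve-∀

  fermat : ∀ a → a ^ p ≡ᶻ a [mod p ]
  fermat (+ zero)      = step-down (≡ᶻ-reflexive (ℤP.^-zeroˡ p))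
  fermat (+ suc n)     = step-up (fermat (+ n))
  fermat -[1+ zero ]   = step-down (fermat (+ zero))
  fermat -[1+ suc n ]  = step-down (fermat -[1+ n ])

Δ : ℕ → (ℕ → ℤ) → ℕ → ℤ
Δ zero    h j = h j
Δ (suc k) h j = Δ k h (suc j) - Δ k h j

Δ-cong : ∀ {h h′} → (∀ j → h j ≡ h′ j) → ∀ k j → Δ k h j ≡ Δ k h′ j
Δ-cong h≡h′ zero    j = h≡h′ j
Δ-cong h≡h′ (suc k) j = cong₂ _-_ (Δ-cong h≡h′ k (suc j)) (Δ-cong h≡h′ k j)

Δ-linear : ∀ c h h′ k j → Δ k (λ i → c * h i + h′ i) j ≡ c * Δ k h j + Δ k h′ j
Δ-linear c h h′ zero    j = refl
Δ-linear c h h′ (suc k) j = begin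
  Δ k (λ i → c * h i + h′ i) (suc j) - Δ k (λ i → c * h i + h′ i) j
    ≡⟨ cong₂ _-_ (Δ-linear c h h′ k (suc j)) (Δ-linear c h h′ k j) ⟩
  (c * Δ k h (suc j) + Δ k h′ (suc j)) - (c * Δ k h j + Δ k h′ j)
    ≡⟨ regroup c (Δ k h (suc j)) (Δ k h′ (suc j)) (Δ k h j) (Δ k h′ j) ⟩
  c * (Δ k h (suc j) - Δ k h j) + (Δ k h′ (suc j) - Δ k h′ j)
    ∎
  where regroup : ∀ c a b x y → (c * a + b) - (c * x + y) ≡ c * (a - x) + (b - y)
        regroup = solve-∀

Δ-zero : ∀ k j → Δ k (λ _ → 0ℤ) j ≡ 0ℤ
Δ-zero zero    j = refl
Δ-zero (suc k) j = cong₂ _-_ (Δ-zero k (suc j)) (Δ-zero k j)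

Δ-const : ∀ c k j → Δ (suc k) (λ _ → c) j ≡ 0ℤ
Δ-const c zero    j = ℤP.+-inverseʳ c
Δ-const c (suc k) j = cong₂ _-_ (Δ-const c k (suc j)) (Δ-const c k j)

Δ-mod : ∀ {n h h′} → (∀ j → h j ≡ᶻ h′ j [mod n ]) → ∀ k j → Δ k h j ≡ᶻ Δ k h′ j [mod n ]
Δ-mod h≡h′ zero    j = h≡h′ j
Δ-mod h≡h′ (suc k) j = -‿cong (Δ-mod h≡h′ k (suc j)) (Δ-mod h≡h′ k j)

Δ-leibniz : ∀ a h k j → Δ (suc k) (λ i → (+ i + a) * h i) j
                        ≡ (+ j + + suc k + a) * Δ (suc k) h j + + suc k * Δ k h j
Δ-leibniz a h zero    j = regroup (+ j) a (h (suc j)) (h j)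
  where regroup : ∀ J A x y → (1ℤ + J + A) * x - (J + A) * y ≡ (J + 1ℤ + A) * (x - y) + 1ℤ * y
        regroup = solve-∀
Δ-leibniz a h (suc k) j = begin
  Δ (suc k) (λ i → (+ i + a) * h i) (suc j) - Δ (suc k) (λ i → (+ i + a) * h i) j
    ≡⟨ cong₂ _-_ (Δ-leibniz a h k (suc j)) (Δ-leibniz a h k j) ⟩
  ((+ suc j + + suc k + a) * Δ (suc k) h (suc j) + + suc k * Δ k h (suc j))
    - ((+ j + + suc k + a) * Δ (suc k) h j + + suc k * Δ k h j)
    ≡⟨ regroup (+ j) (+ suc k) a (Δ (suc k) h (suc j)) (Δ k h (suc j)) (Δ k h j) ⟩
  (+ j + + suc (suc k) + a) * (Δ (suc k) h (suc j) - Δ (suc k) h j)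
    + + suc (suc k) * (Δ k h (suc j) - Δ k h j)
    ∎
  where regroup : ∀ J K A x y z → ((1ℤ + J + K + A) * x + K * y) - ((J + K + A) * (y - z) + K * z)
                    ≡ (J + (1ℤ + K) + A) * (x - (y - z)) + (1ℤ + K) * (y - z)
        regroup = solve-∀

shiftedPower : ℕ → ℕ → ℕ → ℤ
shiftedPower r n j = (+ j + + r) ^ n

-- Δᵏ(j + r)ⁿ at 0 is k!·{n+r brace k+r}_r: both sides satisfy the
-- r-Stirling recurrence, the left one by the Leibniz rule.
Δ-shiftedPower : ∀ r n k → Δ k (shiftedPower r n) 0 ≡ + (k !) * + rStir r n k
Δ-shiftedPower r zero    zero    = refl
Δ-shiftedPower r zero    (suc k) = trans (Δ-const 1ℤ k 0) (sym (ℤP.*-zeroʳ (+ (suc k !))))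
Δ-shiftedPower r (suc n) zero    = begin
  + r * shiftedPower r n 0        ≡⟨ cong (+ r *_) (Δ-shiftedPower r n zero) ⟩
  + r * (1ℤ * + rStir r n 0)      ≡⟨ regroup (+ r) (+ rStir r n 0) ⟩
  1ℤ * (+ r * + rStir r n 0)      ≡⟨ cong (1ℤ *_) (ℤP.pos-* r (rStir r n 0)) ⟨
  1ℤ * + (r ℕ.* rStir r n 0)      ∎
  where regroup : ∀ R S → R * (1ℤ * S) ≡ 1ℤ * (R * S)
        regroup = solve-∀
Δ-shiftedPower r (suc n) (suc k) = begin
  Δ (suc k) (λ j → (+ j + + r) * shiftedPower r n j) 0
    ≡⟨ Δ-leibniz (+ r) (shiftedPower r n) k 0 ⟩
  + (suc k ℕ.+ r) * Δ (suc k) (shiftedPower r n) 0 + + suc k * Δ k (shiftedPower r n) 0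
    ≡⟨ cong₂ (λ u v → + (suc k ℕ.+ r) * u + + suc k * v) (Δ-shiftedPower r n (suc k)) (Δ-shiftedPower r n k) ⟩
  + (suc k ℕ.+ r) * (+ (suc k !) * + S′) + + suc k * (+ (k !) * + S)
    ≡⟨ cong (λ u → + (suc k ℕ.+ r) * (u * + S′) + + suc k * (+ (k !) * + S)) (ℤP.pos-* (suc k) (k !)) ⟩
  + (suc k ℕ.+ r) * ((+ suc k * + (k !)) * + S′) + + suc k * (+ (k !) * + S)
    ≡⟨ regroup (+ suc k) (+ (k !)) (+ (suc k ℕ.+ r)) (+ S) (+ S′) ⟩
  (+ suc k * + (k !)) * (+ S + + (suc k ℕ.+ r) * + S′)
    ≡⟨ cong₂ (λ u v → u * (+ S + v)) (ℤP.pos-* (suc k) (k !)) (ℤP.pos-* (suc k ℕ.+ r) S′) ⟨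
  + (suc k !) * (+ S + + ((suc k ℕ.+ r) ℕ.* S′))
    ≡⟨ cong (+ (suc k !) *_) (ℤP.pos-+ S ((suc k ℕ.+ r) ℕ.* S′)) ⟨
  + (suc k !) * + rStir r (suc n) (suc k)
    ∎
  where
  S  = rStir r n k
  S′ = rStir r n (suc k)
  regroup : ∀ K F A s s′ → A * ((K * F) * s′) + K * (F * s) ≡ (K * F) * (s + A * s′)
  regroup = solve-∀

coeff-tabulate : ∀ (F : ℕ → ℤ) g N → (∀ i → N ≤ i → F (g i) ≡ 0ℤ) →
                 ∀ i → coeff (map F (applyUpTo g N)) i ≡ F (g i)
coeff-tabulate F g zero    vanish i       = sym (vanish i z≤n)
coeff-tabulate F g (suc N) vanish zero    = refl
coeff-tabulate F g (suc N) vanish (suc i) =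
  coeff-tabulate F (λ i → g (suc i)) N (λ i N≤i → vanish (suc i) (s≤s N≤i)) i

-- {n+r brace k+r}_r = 0 for n < k, so the tabulations in Defs are exact.
rStir-vanishes : ∀ r n k → n < k → rStir r n k ≡ 0
rStir-vanishes r zero    (suc k) _ = refl
rStir-vanishes r (suc n) (suc k) (s≤s n<k)
  rewrite rStir-vanishes r n k n<k | rStir-vanishes r n (suc k) (ℕP.m<n⇒m<1+n n<k) =
  ℕP.*-zeroʳ (suc k ℕ.+ r)

coeff-FubiniRS : ∀ n r s k → coeff (FubiniRS n r s) k ≡ + (rStir r n k ℕ.* (k ℕ.+ s) !)
coeff-FubiniRS n r s = coeff-tabulate (λ k → + (rStir r n k ℕ.* (k ℕ.+ s) !)) (λ i → i) (suc n)
  (λ k n<k → cong (λ S → + (S ℕ.* (k ℕ.+ s) !)) (rStir-vanishes r n k n<k))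

coeff-Fubini : ∀ n k → coeff (Fubini n) k ≡ Δ k (λ j → (+ j) ^ n) 0
coeff-Fubini n k = begin
  coeff (Fubini n) k              ≡⟨ coeff-tabulate (λ k → + (Stir n k ℕ.* k !)) (λ i → i) (suc n)
                                       (λ k n<k → cong (λ S → + (S ℕ.* k !)) (rStir-vanishes 0 n k n<k)) k ⟩
  + (Stir n k ℕ.* k !)            ≡⟨ ℤP.pos-* (Stir n k) (k !) ⟩
  + Stir n k * + (k !)            ≡⟨ ℤP.*-comm (+ Stir n k) (+ (k !)) ⟩
  + (k !) * + Stir n k            ≡⟨ Δ-shiftedPower 0 n k ⟨
  Δ k (shiftedPower 0 n) 0        ≡⟨ Δ-cong (λ j → cong (_^ n) (ℤP.+-identityʳ (+ j))) k 0 ⟩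
  Δ k (λ j → (+ j) ^ n) 0           ∎

coeff-umbralAux : ∀ k cs i → coeff (umbralAux k cs) i ≡ Δ i (λ j → (+ j) ^ k * eval cs (+ j)) 0
coeff-umbralAux k []       i =
  sym (trans (Δ-cong (λ j → ℤP.*-zeroʳ ((+ j) ^ k)) i 0) (Δ-zero i 0))
coeff-umbralAux k (c ∷ cs) i = begin
  coeff ((c ·ₚ Fubini k) +ₚ umbralAux (suc k) cs) i
    ≡⟨ coeff-+ (c ·ₚ Fubini k) (umbralAux (suc k) cs) i ⟩
  coeff (c ·ₚ Fubini k) i + coeff (umbralAux (suc k) cs) i
    ≡⟨ cong₂ _+_ (trans (coeff-· c (Fubini k) i) (cong (c *_) (coeff-Fubini k i)))
                 (coeff-umbralAux (suc k) cs i) ⟩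
  c * Δ i (λ j → (+ j) ^ k) 0 + Δ i (λ j → (+ j) ^ suc k * eval cs (+ j)) 0
    ≡⟨ Δ-linear c (λ j → (+ j) ^ k) (λ j → (+ j) ^ suc k * eval cs (+ j)) i 0 ⟨
  Δ i (λ j → c * (+ j) ^ k + (+ j) ^ suc k * eval cs (+ j)) 0
    ≡⟨ Δ-cong (λ j → horner c ((+ j) ^ k) (+ j) (eval cs (+ j))) i 0 ⟩
  Δ i (λ j → (+ j) ^ k * eval (c ∷ cs) (+ j)) 0
    ∎
  where horner : ∀ c P J E → c * P + (J * P) * E ≡ P * (c + J * E)
        horner = solve-∀

coeff-umbral : ∀ h i → coeff (umbral h) i ≡ Δ i (λ j → eval h (+ j)) 0
coeff-umbral h i = trans (coeff-umbralAux 0 h i) (Δ-cong (λ j → ℤP.*-identityˡ (eval h (+ j))) i 0)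

coefficientwise : ∀ {n} A B → (∀ i → coeff A i ≡ᶻ coeff B i [mod n ]) → A ≡ₚ B [mod n ]
coefficientwise A B h i = ∣⇒∣ᵤ (divides-difference (h i))

umbral-mod : ∀ {n} h h′ → (∀ j → eval h (+ j) ≡ᶻ eval h′ (+ j) [mod n ]) →
             umbral h ≡ₚ umbral h′ [mod n ]
umbral-mod h h′ pointwise = coefficientwise (umbral h) (umbral h′) λ i →
  ≡ᶻ-trans (≡ᶻ-reflexive (coeff-umbral h i))
   (≡ᶻ-trans (Δ-mod pointwise i 0) (≡ᶻ-reflexive (sym (coeff-umbral h′ i))))

-- If (j + r)ᴺ ≡ (j + r)ᴺ′ (mod n) at every natural j, then
-- F_N(x;r,s) ≡ F_N′(x;r,s) (mod n): the k-th coefficient of F_N(x;r,s) is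
-- Δᵏ(j + r)ᴺ at 0 times the integer (k + s)!/k!.
FubiniRS-mod : ∀ {n} N N′ r s → (∀ j → shiftedPower r N j ≡ᶻ shiftedPower r N′ j [mod n ]) →
               FubiniRS N r s ≡ₚ FubiniRS N′ r s [mod n ]
FubiniRS-mod N N′ r s pointwise = coefficientwise (FubiniRS N r s) (FubiniRS N′ r s) λ k →
  ≡ᶻ-trans (≡ᶻ-reflexive (as-difference N k))
   (≡ᶻ-trans (*-cong (Δ-mod pointwise k 0) ≡ᶻ-refl) (≡ᶻ-reflexive (sym (as-difference N′ k))))
  where
  k!∣[k+s]! : ∀ k → k ! ℕᵈ.∣ (k ℕ.+ s) !
  k!∣[k+s]! k = ℕᵈ.m≤n⇒m!∣n! (ℕP.m≤m+n k s)
  as-difference : ∀ M k → coeff (FubiniRS M r s) k ≡ Δ k (shiftedPower r M) 0 * + ℕᵈ.quotient (k!∣[k+s]! k)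
  as-difference M k = begin
    coeff (FubiniRS M r s) k                  ≡⟨ coeff-FubiniRS M r s k ⟩
    + (S ℕ.* (k ℕ.+ s) !)                     ≡⟨ cong (λ f → + (S ℕ.* f)) (ℕᵈ._∣_.equality (k!∣[k+s]! k)) ⟩
    + (S ℕ.* (Q ℕ.* k !))                     ≡⟨ ℤP.pos-* S (Q ℕ.* k !) ⟩
    + S * + (Q ℕ.* k !)                       ≡⟨ cong (+ S *_) (ℤP.pos-* Q (k !)) ⟩
    + S * (+ Q * + (k !))                     ≡⟨ regroup (+ S) (+ Q) (+ (k !)) ⟩
    + (k !) * + S * + Q                       ≡⟨ cong (_* + Q) (Δ-shiftedPower r M k) ⟨
    Δ k (shiftedPower r M) 0 * + Q            ∎
    where
    S = rStir r M k
    Q = ℕᵈ.quotient (k!∣[k+s]! k)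
    regroup : ∀ S Q F → S * (Q * F) ≡ F * S * Q
    regroup = solve-∀

fermat-exponent : ∀ {p} → Prime p → ∀ a m q → a ^ (m ℕ.* p ℕ.+ q) ≡ᶻ a ^ (m ℕ.+ q) [mod p ]
fermat-exponent {p} pp a m q =
  ≡ᶻ-trans (≡ᶻ-reflexive split)
   (≡ᶻ-trans (*-cong (^-cong m (fermat pp a)) ≡ᶻ-refl)
    (≡ᶻ-reflexive (sym (ℤP.^-distribˡ-+-* a m q))))
  where
  split : a ^ (m ℕ.* p ℕ.+ q) ≡ (a ^ p) ^ m * a ^ q
  split = begin
    a ^ (m ℕ.* p ℕ.+ q)         ≡⟨ ℤP.^-distribˡ-+-* a (m ℕ.* p) q ⟩
    a ^ (m ℕ.* p) * a ^ q       ≡⟨ cong (λ e → a ^ e * a ^ q) (ℕP.*-comm m p) ⟩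
    a ^ (p ℕ.* m) * a ^ q       ≡⟨ cong (_* a ^ q) (ℤP.^-*-assoc a p m) ⟨
    (a ^ p) ^ m * a ^ q         ∎

corollary11 : (p : ℕ) → Prime p →
    ((f g : Poly) → umbral ((f ^ₚ p) *ₚ g) ≡ₚ umbral (f *ₚ g) [mod p ])
    × ((m q r s : ℕ) → FubiniRS (m ℕ.* p ℕ.+ q) r s ≡ₚ FubiniRS (m ℕ.+ q) r s [mod p ])
corollary11 p pp = umbral-part , FubiniRS-part
  where
  umbral-part : (f g : Poly) → umbral ((f ^ₚ p) *ₚ g) ≡ₚ umbral (f *ₚ g) [mod p ]
  umbral-part f g = umbral-mod ((f ^ₚ p) *ₚ g) (f *ₚ g) λ j →
    ≡ᶻ-trans (≡ᶻ-reflexive (trans (eval-* (f ^ₚ p) g (+ j)) (cong (_* eval g (+ j)) (eval-^ f p (+ j)))))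
     (≡ᶻ-trans (*-cong (fermat pp (eval f (+ j))) ≡ᶻ-refl)
      (≡ᶻ-reflexive (sym (eval-* f g (+ j)))))
  FubiniRS-part : (m q r s : ℕ) → FubiniRS (m ℕ.* p ℕ.+ q) r s ≡ₚ FubiniRS (m ℕ.+ q) r s [mod p ]
  FubiniRS-part m q r s =
    FubiniRS-mod (m ℕ.* p ℕ.+ q) (m ℕ.+ q) r s (λ j → fermat-exponent pp (+ j + + r) m q)
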